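{- Let $Pol$ be the set of tropically polarized functions on $\Pi$. The map $\alpha^*:Pol\to \{g:\{0,\dots,n\}^2\to\mathbb{R}\ :\ g(i,j)=0 \text{ whenever } ij=0\}$, $f\mapsto f\circ\alpha$, is a bijection, and likewise the map $\beta^*:Pol\to \{h:\{0,\dots,n\}^2\to\mathbb{R}\ :\ h(i,j)=0 \text{ whenever } ij=0\}$, $f\mapsto f\circ\beta$, is a bijection.
   Context: $\Pi$ is the set of integer points $(i,j,k)$ with $0\le k\le n$, $k\le i,j\le 2n-k$, and $i\equiv j\equiv k \pmod 2$. A center of an elementary octahedron is an integer point $(i,j,k)$ with $1\le k\le n-1$, $k+1\le i,j\le 2n-k-1$, $i\equiv j\equiv k+1\pmod 2$. A function $f:\Pi\to\mathbb{R}$ is tropically polarized if $f(i,j,0)=0$ for all $(i,j,0)\in\Pi$ and for every center $(i,j,k)$ of an elementary octahedron $$f(i-1,j-1,k)+f(i+1,j+1,k)=\max\bigl(f(i,j,k-1)+f(i,j,k+1),\ f(i-1,j+1,k)+f(i+1,j-1,k)\bigr).$$ The maps $\alpha,\beta:\{0,\dots,n\}^2\to\Pi$ are $\alpha(i,j)=(2i-\min(i,j),\,2j-\min(i,j),\,\min(i,j))$ and $\beta(i,j)=(2n-2i+\min(i,j),\,2n-2j+\min(i,j),\,\min(i,j))$. (For $f\in Pol$, $f\circ\alpha$ and $f\circ\beta$ vanish when $ij=0$ since these points lie on level $0$.) -}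

module Defs where

open import Level using (Level; suc; _⊔_)
open import Data.Nat as ℕ using (ℕ; zero; _∸_; _≤_; _%_; _⊓_)
open import Data.Product using (Σ; ∃; _×_; _,_)
open import Data.Sum using (_⊎_)
open import Relation.Binary.PropositionalEquality using (_≡_)

-- A linearly ordered abelian group, presented via its max operation _∨_
-- (x ≤ y iff x ∨ y ≡ y).  ℝ with +, -, 0, max is an instance; the
-- statement is made for every such structure.
record LOAGroup (c : Level) : Set (Level.suc c) where
  infixl 6 _+_
  infixl 5 _∨_
  field
    Carrier    : Set c
    0#         : Carrier
    _+_        : Carrier → Carrier → Carrier
    -_         : Carrier → Carrier
    _∨_        : Carrier → Carrier → Carrier
    +-assoc    : ∀ x y z → (x + y) + z ≡ x + (y + z)
    +-comm     : ∀ x y → x + y ≡ y + x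
    +-identityˡ : ∀ x → 0# + x ≡ x
    -‿inverseˡ : ∀ x → (- x) + x ≡ 0#
    ∨-assoc    : ∀ x y z → (x ∨ y) ∨ z ≡ x ∨ (y ∨ z)
    ∨-comm     : ∀ x y → x ∨ y ≡ y ∨ x
    ∨-idem     : ∀ x → x ∨ x ≡ x
    ∨-total    : ∀ x y → (x ∨ y ≡ x) ⊎ (x ∨ y ≡ y)
    +-distrib-∨ : ∀ x y z → x + (y ∨ z) ≡ (x + y) ∨ (x + z)

module _ {c : Level} (G : LOAGroup c) where
  open LOAGroup G

  InΠ : ℕ → ℕ → ℕ → ℕ → Set
  InΠ n i j k =
    k ≤ n × k ≤ i × i ≤ 2 ℕ.* n ∸ k × k ≤ j × j ≤ 2 ℕ.* n ∸ k
    × i % 2 ≡ k % 2 × j % 2 ≡ k % 2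

  Center : ℕ → ℕ → ℕ → ℕ → Set
  Center n i j k =
    1 ≤ k × k ≤ n ∸ 1
    × ℕ.suc k ≤ i × i ≤ 2 ℕ.* n ∸ k ∸ 1
    × ℕ.suc k ≤ j × j ≤ 2 ℕ.* n ∸ k ∸ 1
    × i % 2 ≡ (ℕ.suc k) % 2 × j % 2 ≡ (ℕ.suc k) % 2

  -- A function on Π is represented by a function on ℕ³; only its values
  -- on Π are ever used (all equalities below are restricted to Π).
  Fun : Set c
  Fun = ℕ → ℕ → ℕ → Carrier

  -- Tropically polarized.  At a center, i,j,k ≥ 1, so ∸ 1 is exact.
  IsPol : ℕ → Fun → Set c
  IsPol n f =
    (∀ i j → InΠ n i j 0 → f i j 0 ≡ 0#)
    × (∀ i j k → Center n i j k →
         f (i ∸ 1) (j ∸ 1) k + f (ℕ.suc i) (ℕ.suc j) k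
         ≡ (f i j (k ∸ 1) + f i j (ℕ.suc k))
           ∨ (f (i ∸ 1) (ℕ.suc j) k + f (ℕ.suc i) (j ∸ 1) k))

  _≈Π[_]_ : Fun → ℕ → Fun → Set c
  f ≈Π[ n ] f' = ∀ i j k → InΠ n i j k → f i j k ≡ f' i j k

  Grid : Set c
  Grid = ℕ → ℕ → Carrier

  Vanishing : ℕ → Grid → Set c
  Vanishing n g = ∀ i j → i ≤ n → j ≤ n → i ℕ.* j ≡ 0 → g i j ≡ 0#

  _≈G[_]_ : Grid → ℕ → Grid → Set c
  g ≈G[ n ] g' = ∀ i j → i ≤ n → j ≤ n → g i j ≡ g' i j

  -- α and β (all subtractions are exact for i,j ≤ n).
  α : ℕ → ℕ → ℕ → ℕ × ℕ × ℕ
  α n i j = (2 ℕ.* i ∸ (i ⊓ j) , 2 ℕ.* j ∸ (i ⊓ j) , i ⊓ j)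

  β : ℕ → ℕ → ℕ → ℕ × ℕ × ℕ
  β n i j = ((2 ℕ.* n ∸ 2 ℕ.* i) ℕ.+ (i ⊓ j) , (2 ℕ.* n ∸ 2 ℕ.* j) ℕ.+ (i ⊓ j) , i ⊓ j)

  _∘³_ : Fun → (ℕ → ℕ → ℕ × ℕ × ℕ) → Grid
  (f ∘³ φ) i j with φ i j
  ... | (a , b , k) = f a b k

  PullbackBijective : ℕ → (ℕ → ℕ → ℕ × ℕ × ℕ) → Set c
  PullbackBijective n φ =
    (∀ f → IsPol n f → Vanishing n (f ∘³ φ))
    × (∀ f f' → IsPol n f → IsPol n f' →
         (f ∘³ φ) ≈G[ n ] (f' ∘³ φ) → f ≈Π[ n ] f')
    × (∀ g → Vanishing n g →
         Σ Fun (λ f → IsPol n f × ((f ∘³ φ) ≈G[ n ] g)))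

{-# OPTIONS --safe #-}
module Submission where

open import Level using (Level)
open import Data.Nat using (ℕ; zero; suc; _+_; _*_; _∸_; _/_; _%_; _≤_; _<_; _⊓_; z≤n; s≤s)
open import Data.Product using (_×_; Σ; ∃-syntax; _,_; proj₁; proj₂)
open import Defs

open import Data.Nat.Properties
open import Data.Nat.DivMod using (m≡m%n+[m/n]*n; [m+kn]%n≡m%n; %-congˡ; /-congˡ; /-monoˡ-≤; m*n/n≡m)
open import Data.Nat.Tactic.RingSolver using (solve-∀)
open import Data.Sum using (inj₁; inj₂)
open import Function using (id)
open import Relation.Binary.PropositionalEquality

-- Write the points of Π at level k as (k + 2p, k + 2q, k) with k + p ≤ n and k + q ≤ n. In these
-- coordinates the octahedron whose centre lies over level k + 1 relates f at (k + 1, p + 1, q + 1)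
-- to values with smaller p, or equal p and smaller q, or equal p and q and smaller k; since the
-- values form a group, the relation can be solved for that value. So by recursion on (p, q, k),
-- a polarized function is determined by its faces p = 0 and q = 0, and arbitrary values on the
-- faces (zero at level 0) extend to one. The map α is a bijection from {0,…,n}² onto these faces:
-- α (k, k + q) = (k, 0, q) and α (k + p, k) = (k, p, 0). Finally β is α followed by the reflection
-- (i, j, k) ↦ (2n − i, 2n − j, k), which preserves Π, the centres and the octahedron relation.

offset-suc : ∀ k p → k + 2 * suc p ≡ suc (suc (k + 2 * p))
offset-suc = solve-∀

offset-parity : ∀ k p → (k + 2 * p) % 2 ≡ k % 2
offset-parity k p = trans (%-congˡ (cong (k +_) (*-comm 2 p))) ([m+kn]%n≡m%n k p 2)

offset-by-parity : ∀ {k i} → k ≤ i → i % 2 ≡ k % 2 → ∃[ p ] i ≡ k + 2 * p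
offset-by-parity {k} {i} k≤i i≡k = p , (begin
    i                         ≡⟨ m≡m%n+[m/n]*n i 2 ⟩
    i % 2 + i / 2 * 2         ≡⟨ cong₂ (λ r a → r + a * 2) i≡k (sym (m+[n∸m]≡n (/-monoˡ-≤ 2 k≤i))) ⟩
    k % 2 + (k / 2 + p) * 2   ≡⟨ regroup (k % 2) (k / 2) p ⟩
    k % 2 + k / 2 * 2 + 2 * p ≡⟨ cong (_+ 2 * p) (sym (m≡m%n+[m/n]*n k 2)) ⟩
    k + 2 * p                 ∎)
  where
  open ≡-Reasoning
  p = i / 2 ∸ k / 2
  regroup : ∀ r a p → r + (a + p) * 2 ≡ r + a * 2 + 2 * p
  regroup = solve-∀

double-offset : ∀ k p → 2 * (k + p) ≡ k + 2 * p + k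
double-offset = solve-∀

offset-bound : ∀ {k p n} → k + p ≤ n → k + 2 * p ≤ 2 * n ∸ k
offset-bound {k} {p} {n} h =
  m+n≤o⇒m≤o∸n (k + 2 * p) (subst (_≤ 2 * n) (double-offset k p) (*-monoʳ-≤ 2 h))

offset-bound⁻¹ : ∀ {k p n} → k ≤ n → k + 2 * p ≤ 2 * n ∸ k → k + p ≤ n
offset-bound⁻¹ {k} {p} {n} k≤n h = *-cancelˡ-≤ 2 (subst (_≤ 2 * n) (sym (double-offset k p))
  (m≤o∸n⇒m+n≤o (k + 2 * p) (≤-trans k≤n (m≤m+n n (n + 0))) h))

mirror-offset : ∀ {k p n} → k + p ≤ n → 2 * n ∸ (k + 2 * p) ≡ k + 2 * (n ∸ (k + p))
mirror-offset {k} {p} {n} h = begin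
    2 * n ∸ (k + 2 * p)                     ≡⟨ cong (λ m → 2 * m ∸ (k + 2 * p)) (sym (m+[n∸m]≡n h)) ⟩
    2 * (k + p + r) ∸ (k + 2 * p)           ≡⟨ cong (_∸ (k + 2 * p)) (split k p r) ⟩
    (k + 2 * p) + (k + 2 * r) ∸ (k + 2 * p) ≡⟨ m+n∸m≡n (k + 2 * p) (k + 2 * r) ⟩
    k + 2 * r                               ∎
  where
  open ≡-Reasoning
  r = n ∸ (k + p)
  split : ∀ k p r → 2 * (k + p + r) ≡ (k + 2 * p) + (k + 2 * r)
  split = solve-∀

mirror-offset-bound : ∀ {k p n} → k + p ≤ n → k + (n ∸ (k + p)) ≤ n
mirror-offset-bound {k} {p} {n} h =
  ≤-trans (+-monoˡ-≤ (n ∸ (k + p)) (m≤m+n k p)) (≤-reflexive (m+[n∸m]≡n h))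

[m∸n]+o≡m∸[n∸o] : ∀ {m n o} → o ≤ n → n ≤ m → (m ∸ n) + o ≡ m ∸ (n ∸ o)
[m∸n]+o≡m∸[n∸o] {m} {n} {o} o≤n n≤m = begin
    (m ∸ n) + o         ≡⟨ cong (λ a → (m ∸ a) + o) (sym (m∸n+n≡m o≤n)) ⟩
    (m ∸ (x + o)) + o   ≡⟨ cong (_+ o) (sym (∸-+-assoc m x o)) ⟩
    (m ∸ x ∸ o) + o     ≡⟨ m∸n+n≡m (m+n≤o⇒m≤o∸n o (subst (_≤ m) (trans (sym (m∸n+n≡m o≤n)) (+-comm x o)) n≤m)) ⟩
    m ∸ x               ∎
  where
  open ≡-Reasoning
  x = n ∸ o

m∸[n∸1]≡1+[m∸n] : ∀ {m n} → 1 ≤ n → n ≤ m → m ∸ (n ∸ 1) ≡ suc (m ∸ n)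
m∸[n∸1]≡1+[m∸n] {n = suc n} _ n<m = +-∸-assoc 1 n<m

m∸[1+n]≡m∸n∸1 : ∀ m n → m ∸ suc n ≡ m ∸ n ∸ 1
m∸[1+n]≡m∸n∸1 m n = sym (trans (∸-+-assoc m n 1) (cong (m ∸_) (+-comm n 1)))

2*[m+n]∸m≡m+2*n : ∀ m n → 2 * (m + n) ∸ m ≡ m + 2 * n
2*[m+n]∸m≡m+2*n m n = trans (cong (_∸ m) (regroup m n)) (m+n∸m≡n m (m + 2 * n))
  where
  regroup : ∀ m n → 2 * (m + n) ≡ m + (m + 2 * n)
  regroup = solve-∀

<⇒≤∸1 : ∀ {m n} → m < n → m ≤ n ∸ 1
<⇒≤∸1 {n = suc n} m<n = ≤-pred m<n

≤∸1⇒< : ∀ {m n} → 1 ≤ m → m ≤ n ∸ 1 → m < n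
≤∸1⇒< {suc m} {zero}  _ ()
≤∸1⇒< {m}     {suc n} _ m≤n = s≤s m≤n

data Diagonal : ℕ → ℕ → Set where
  above : ∀ k q → Diagonal k (k + q)
  below : ∀ k p → Diagonal (k + p) k

diagonal : ∀ i j → Diagonal i j
diagonal zero    j       = above 0 j
diagonal (suc i) zero    = below 0 (suc i)
diagonal (suc i) (suc j) with diagonal i j
... | above k q = above (suc k) q
... | below k p = below (suc k) p

module _ {c : Level} (G : LOAGroup c) where
  open LOAGroup G renaming
    (_+_ to _⊕_; -_ to ⊖_; +-assoc to ⊕-assoc; +-comm to ⊕-comm; +-identityˡ to ⊕-identityˡ)

  ⊖-cancelˡ : ∀ a b → ⊖ a ⊕ (a ⊕ b) ≡ b
  ⊖-cancelˡ a b = trans (sym (⊕-assoc (⊖ a) a b)) (trans (cong (_⊕ b) (-‿inverseˡ a)) (⊕-identityˡ b))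

  ⊖-cancelʳ : ∀ a b → a ⊕ (⊖ a ⊕ b) ≡ b
  ⊖-cancelʳ a b = begin
    a ⊕ (⊖ a ⊕ b) ≡⟨ sym (⊕-assoc a (⊖ a) b) ⟩
    (a ⊕ ⊖ a) ⊕ b ≡⟨ cong (_⊕ b) (⊕-comm a (⊖ a)) ⟩
    (⊖ a ⊕ a) ⊕ b ≡⟨ ⊕-assoc (⊖ a) a b ⟩
    ⊖ a ⊕ (a ⊕ b) ≡⟨ ⊖-cancelˡ a b ⟩
    b             ∎
    where open ≡-Reasoning

  ⊕-cancelˡ : ∀ a {b b′} → a ⊕ b ≡ a ⊕ b′ → b ≡ b′
  ⊕-cancelˡ a {b} {b′} e = trans (sym (⊖-cancelˡ a b)) (trans (cong (⊖ a ⊕_) e) (⊖-cancelˡ a b′))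

  module _ (n : ℕ) where

    data InΠView : ℕ → ℕ → ℕ → Set where
      point : ∀ k p q → k + p ≤ n → k + q ≤ n → InΠView (k + 2 * p) (k + 2 * q) k

    inΠ-point : ∀ {k p q} → k + p ≤ n → k + q ≤ n → InΠ G n (k + 2 * p) (k + 2 * q) k
    inΠ-point {k} {p} {q} hp hq =
      m+n≤o⇒m≤o k hp , m≤m+n k (2 * p) , offset-bound {k} {p} hp , m≤m+n k (2 * q) , offset-bound {k} {q} hq
      , offset-parity k p , offset-parity k q

    inΠ-view : ∀ {i j k} → InΠ G n i j k → InΠView i j k
    inΠ-view (k≤n , k≤i , i≤ , k≤j , j≤ , i≡k , j≡k)
      with offset-by-parity k≤i i≡k | offset-by-parity k≤j j≡k
    ... | p , refl | q , refl = point _ p q (offset-bound⁻¹ k≤n i≤) (offset-bound⁻¹ k≤n j≤)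

    center⇒inΠ : ∀ {i j k} → Center G n i j (suc k) → InΠ G n i j (suc (suc k))
    center⇒inΠ {i} {j} {k} (1≤k , k≤n , k<i , i≤ , k<j , j≤ , i≡k , j≡k) =
      ≤∸1⇒< 1≤k k≤n , k<i , subst (i ≤_) (sym (m∸[1+n]≡m∸n∸1 (2 * n) (suc k))) i≤
      , k<j , subst (j ≤_) (sym (m∸[1+n]≡m∸n∸1 (2 * n) (suc k))) j≤ , i≡k , j≡k

    inΠ⇒center : ∀ {i j k} → InΠ G n i j (suc (suc k)) → Center G n i j (suc k)
    inΠ⇒center {i} {j} {k} (k<n , k<i , i≤ , k<j , j≤ , i≡k , j≡k) =
      s≤s z≤n , <⇒≤∸1 k<n , k<i , subst (i ≤_) (m∸[1+n]≡m∸n∸1 (2 * n) (suc k)) i≤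
      , k<j , subst (j ≤_) (m∸[1+n]≡m∸n∸1 (2 * n) (suc k)) j≤ , i≡k , j≡k

    coords : Fun G → ℕ → ℕ → ℕ → Carrier
    coords f k p q = f (k + 2 * p) (k + 2 * q) k

    uncoords : (ℕ → ℕ → ℕ → Carrier) → Fun G
    uncoords F i j k = F k ((i ∸ k) / 2) ((j ∸ k) / 2)

    coords-uncoords : ∀ F k p q → coords (uncoords F) k p q ≡ F k p q
    coords-uncoords F k p q = cong₂ (F k) (half p) (half q)
      where
      half : ∀ p → (k + 2 * p ∸ k) / 2 ≡ p
      half p = trans (/-congˡ (trans (m+n∸m≡n k (2 * p)) (*-comm 2 p))) (m*n/n≡m p 2)

    OctahedronAt : Fun G → ℕ → ℕ → ℕ → Set c
    OctahedronAt f i j k =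
      f (i ∸ 1) (j ∸ 1) k ⊕ f (suc i) (suc j) k
      ≡ (f i j (k ∸ 1) ⊕ f i j (suc k)) ∨ (f (i ∸ 1) (suc j) k ⊕ f (suc i) (j ∸ 1) k)

    Octahedron : (ℕ → ℕ → ℕ → Carrier) → ℕ → ℕ → ℕ → Set c
    Octahedron F k p q =
      F (suc k) p q ⊕ F (suc k) (suc p) (suc q)
      ≡ (F k (suc p) (suc q) ⊕ F (suc (suc k)) p q) ∨ (F (suc k) p (suc q) ⊕ F (suc k) (suc p) q)

    octahedronAt-coords : ∀ f k p q →
      OctahedronAt f (suc (suc k) + 2 * p) (suc (suc k) + 2 * q) (suc k) ≡ Octahedron (coords f) k p q
    octahedronAt-coords f k p q = cong₂ _≡_
      (cong (coords f (suc k) p q ⊕_) (at (suc k) (sym (offset-suc (suc k) p)) (sym (offset-suc (suc k) q))))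
      (cong₂ _∨_
        (cong (_⊕ coords f (suc (suc k)) p q) (at k (sym (offset-suc k p)) (sym (offset-suc k q))))
        (cong₂ _⊕_ (at (suc k) refl (sym (offset-suc (suc k) q))) (at (suc k) (sym (offset-suc (suc k) p)) refl)))
      where
      at : ∀ l {a a′ b b′} → a ≡ a′ → b ≡ b′ → f a b l ≡ f a′ b′ l
      at l = cong₂ (λ a b → f a b l)

    record IsPolᶜ (F : ℕ → ℕ → ℕ → Carrier) : Set c where
      field
        base       : ∀ p q → p ≤ n → q ≤ n → F 0 p q ≡ 0#
        octahedron : ∀ k p q → suc (suc k) + p ≤ n → suc (suc k) + q ≤ n → Octahedron F k p q

    isPol⇒isPolᶜ : ∀ {f} → IsPol G n f → IsPolᶜ (coords f)
    isPol⇒isPolᶜ {f} (base , octahedronAt) = record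
      { base       = λ p q p≤n q≤n → base (2 * p) (2 * q) (inΠ-point p≤n q≤n)
      ; octahedron = λ k p q hp hq →
          subst id (octahedronAt-coords f k p q) (octahedronAt _ _ _ (inΠ⇒center (inΠ-point hp hq)))
      }

    isPolᶜ⇒isPol : ∀ {f} → IsPolᶜ (coords f) → IsPol G n f
    isPolᶜ⇒isPol {f} P = base , octahedronAt
      where
      open IsPolᶜ P using (octahedron)
      base : ∀ i j → InΠ G n i j 0 → f i j 0 ≡ 0#
      base i j h with inΠ-view h
      ... | point _ p q hp hq = IsPolᶜ.base P p q hp hq
      octahedronAt : ∀ i j k → Center G n i j k → OctahedronAt f i j k
      octahedronAt i j zero    (() , _)
      octahedronAt i j (suc k) h with inΠ-view (center⇒inΠ h)
      ... | point _ p q hp hq = subst id (sym (octahedronAt-coords f k p q)) (octahedron k p q hp hq)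

    isPolᶜ-resp : ∀ {F F′} → (∀ k p q → F k p q ≡ F′ k p q) → IsPolᶜ F → IsPolᶜ F′
    isPolᶜ-resp {F} {F′} F≗F′ P = record
      { base       = λ p q p≤n q≤n → trans (sym (F≗F′ 0 p q)) (base p q p≤n q≤n)
      ; octahedron = λ k p q hp hq → subst₂ _≡_
          (cong₂ _⊕_ (F≗F′ _ _ _) (F≗F′ _ _ _))
          (cong₂ _∨_ (cong₂ _⊕_ (F≗F′ _ _ _) (F≗F′ _ _ _)) (cong₂ _⊕_ (F≗F′ _ _ _) (F≗F′ _ _ _)))
          (octahedron k p q hp hq)
      }
      where open IsPolᶜ P

    module _ {F F′ : ℕ → ℕ → ℕ → Carrier} (P : IsPolᶜ F) (P′ : IsPolᶜ F′)
             (agree-p₀ : ∀ k q → k + q ≤ n → F k 0 q ≡ F′ k 0 q)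
             (agree-q₀ : ∀ k p → k + p ≤ n → F k p 0 ≡ F′ k p 0) where

      isPolᶜ-unique : ∀ k p q → k + p ≤ n → k + q ≤ n → F k p q ≡ F′ k p q
      isPolᶜ-unique k       zero    q       _  hq = agree-p₀ k q hq
      isPolᶜ-unique k       (suc p) zero    hp _  = agree-q₀ k (suc p) hp
      isPolᶜ-unique zero    (suc p) (suc q) hp hq =
        trans (IsPolᶜ.base P (suc p) (suc q) hp hq) (sym (IsPolᶜ.base P′ (suc p) (suc q) hp hq))
      isPolᶜ-unique (suc k) (suc p) (suc q) hp hq = ⊕-cancelˡ (F (suc k) p q) (begin
          F (suc k) p q ⊕ F (suc k) (suc p) (suc q)
            ≡⟨ IsPolᶜ.octahedron P k p q hp′ hq′ ⟩
          (F k (suc p) (suc q) ⊕ F (suc (suc k)) p q) ∨ (F (suc k) p (suc q) ⊕ F (suc k) (suc p) q)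
            ≡⟨ cong₂ _∨_
                 (cong₂ _⊕_ (isPolᶜ-unique k (suc p) (suc q) (<⇒≤ hp) (<⇒≤ hq))
                            (isPolᶜ-unique (suc (suc k)) p q hp′ hq′))
                 (cong₂ _⊕_ (isPolᶜ-unique (suc k) p (suc q) (shrink hp) hq)
                            (isPolᶜ-unique (suc k) (suc p) q hp (shrink hq))) ⟩
          (F′ k (suc p) (suc q) ⊕ F′ (suc (suc k)) p q) ∨ (F′ (suc k) p (suc q) ⊕ F′ (suc k) (suc p) q)
            ≡⟨ sym (IsPolᶜ.octahedron P′ k p q hp′ hq′) ⟩
          F′ (suc k) p q ⊕ F′ (suc k) (suc p) (suc q)
            ≡⟨ cong (_⊕ F′ (suc k) (suc p) (suc q)) (sym (isPolᶜ-unique (suc k) p q (shrink hp) (shrink hq))) ⟩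
          F (suc k) p q ⊕ F′ (suc k) (suc p) (suc q) ∎)
        where
        open ≡-Reasoning
        shrink : ∀ {r} → suc k + suc r ≤ n → suc k + r ≤ n
        shrink = ≤-trans (+-monoʳ-≤ (suc k) (n≤1+n _))
        hp′ : suc (suc k) + p ≤ n
        hp′ = subst (_≤ n) (cong suc (+-suc k p)) hp
        hq′ : suc (suc k) + q ≤ n
        hq′ = subst (_≤ n) (cong suc (+-suc k q)) hq

    module _ (g : Grid G) where

      extend : ℕ → ℕ → ℕ → Carrier
      extend k       zero    q       = g k (k + q)
      extend k       (suc p) zero    = g (k + suc p) k
      extend zero    (suc p) (suc q) = 0#
      extend (suc k) (suc p) (suc q) =
        ⊖ extend (suc k) p q
        ⊕ ((extend k (suc p) (suc q) ⊕ extend (suc (suc k)) p q) ∨ (extend (suc k) p (suc q) ⊕ extend (suc k) (suc p) q))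

      extend-isPolᶜ : Vanishing G n g → IsPolᶜ extend
      extend-isPolᶜ vanish = record
        { base       = base
        ; octahedron = λ k p q _ _ → ⊖-cancelʳ (extend (suc k) p q) _
        }
        where
        base : ∀ p q → p ≤ n → q ≤ n → extend 0 p q ≡ 0#
        base zero    q       _   q≤n = vanish 0 q z≤n q≤n refl
        base (suc p) zero    p≤n _   = vanish (suc p) 0 p≤n z≤n (*-zeroʳ (suc p))
        base (suc p) (suc q) _   _   = refl

      extend-q₀ : ∀ k p → extend k p 0 ≡ g (k + p) k
      extend-q₀ k zero    = cong₂ g (sym (+-identityʳ k)) (+-identityʳ k)
      extend-q₀ k (suc p) = refl

    _≈Π_ : Fun G → Fun G → Set c
    f ≈Π f′ = _≈Π[_]_ G f n f′

    _≈G_ : Grid G → Grid G → Set c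
    g ≈G g′ = _≈G[_]_ G g n g′

    α* : Fun G → Grid G
    α* f = _∘³_ G f (α G n)

    α-above : ∀ k q → α G n k (k + q) ≡ (k + 2 * 0 , k + 2 * q , k)
    α-above k q = begin
      α G n k (k + q)                     ≡⟨ cong (λ m → 2 * k ∸ m , 2 * (k + q) ∸ m , m) (m≤n⇒m⊓n≡m (m≤m+n k q)) ⟩
      (2 * k ∸ k , 2 * (k + q) ∸ k , k)  ≡⟨ cong₂ _,_ (m+n∸m≡n k (k + 0)) (cong (_, k) (2*[m+n]∸m≡m+2*n k q)) ⟩
      (k + 2 * 0 , k + 2 * q , k)         ∎
      where open ≡-Reasoning

    α-below : ∀ k p → α G n (k + p) k ≡ (k + 2 * p , k + 2 * 0 , k)
    α-below k p = begin
      α G n (k + p) k                     ≡⟨ cong (λ m → 2 * (k + p) ∸ m , 2 * k ∸ m , m) (m≥n⇒m⊓n≡n (m≤m+n k p)) ⟩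
      (2 * (k + p) ∸ k , 2 * k ∸ k , k)  ≡⟨ cong₂ _,_ (2*[m+n]∸m≡m+2*n k p) (cong (_, k) (m+n∸m≡n k (k + 0))) ⟩
      (k + 2 * p , k + 2 * 0 , k)         ∎
      where open ≡-Reasoning

    α*-above : ∀ f k q → α* f k (k + q) ≡ coords f k 0 q
    α*-above f k q = cong (λ (a , b , l) → f a b l) (α-above k q)

    α*-below : ∀ f k p → α* f (k + p) k ≡ coords f k p 0
    α*-below f k p = cong (λ (a , b , l) → f a b l) (α-below k p)

    α*-vanishing : ∀ f → IsPol G n f → Vanishing G n (α* f)
    α*-vanishing f pol i j i≤n j≤n ij≡0 with m*n≡0⇒m≡0∨n≡0 i ij≡0
    ... | inj₁ refl = trans (α*-above f 0 j) (IsPolᶜ.base (isPol⇒isPolᶜ {f} pol) 0 j z≤n j≤n)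
    ... | inj₂ refl = trans (α*-below f 0 i) (IsPolᶜ.base (isPol⇒isPolᶜ {f} pol) i 0 i≤n z≤n)

    α*-injective : ∀ f f′ → IsPol G n f → IsPol G n f′ → α* f ≈G α* f′ → f ≈Π f′
    α*-injective f f′ pol pol′ α*f≈α*f′ i j k inΠ with inΠ-view inΠ
    ... | point k p q hp hq =
      isPolᶜ-unique (isPol⇒isPolᶜ {f} pol) (isPol⇒isPolᶜ {f′} pol′) agree-p₀ agree-q₀ k p q hp hq
      where
      agree-p₀ : ∀ k q → k + q ≤ n → coords f k 0 q ≡ coords f′ k 0 q
      agree-p₀ k q h =
        trans (sym (α*-above f k q)) (trans (α*f≈α*f′ k (k + q) (m+n≤o⇒m≤o k h) h) (α*-above f′ k q))
      agree-q₀ : ∀ k p → k + p ≤ n → coords f k p 0 ≡ coords f′ k p 0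
      agree-q₀ k p h =
        trans (sym (α*-below f k p)) (trans (α*f≈α*f′ (k + p) k h (m+n≤o⇒m≤o k h)) (α*-below f′ k p))

    α*-surjective : ∀ g → Vanishing G n g → Σ (Fun G) λ f → IsPol G n f × α* f ≈G g
    α*-surjective g vanish = f , pol , α*f≈g
      where
      f = uncoords (extend g)
      pol : IsPol G n f
      pol = isPolᶜ⇒isPol {f}
        (isPolᶜ-resp (λ k p q → sym (coords-uncoords (extend g) k p q)) (extend-isPolᶜ g vanish))
      α*f≈g : α* f ≈G g
      α*f≈g i j _ _ with diagonal i j
      ... | above k q = trans (α*-above f k q) (coords-uncoords (extend g) k 0 q)
      ... | below k p = trans (α*-below f k p) (trans (coords-uncoords (extend g) k p 0) (extend-q₀ g k p))

    reflect : Fun G → Fun G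
    reflect f i j k = f (2 * n ∸ i) (2 * n ∸ j) k

    reflect-involutive : ∀ f {a b} k → a ≤ 2 * n → b ≤ 2 * n → reflect (reflect f) a b k ≡ f a b k
    reflect-involutive f k a≤ b≤ = cong₂ (λ a b → f a b k) (m∸[m∸n]≡n a≤) (m∸[m∸n]≡n b≤)

    inΠ-bounded : ∀ {i j k} → InΠ G n i j k → i ≤ 2 * n × j ≤ 2 * n
    inΠ-bounded {k = k} (_ , _ , i≤ , _ , j≤ , _) = ≤-trans i≤ (m∸n≤m (2 * n) k) , ≤-trans j≤ (m∸n≤m (2 * n) k)

    inΠ-reflect : ∀ {i j k} → InΠ G n i j k → InΠ G n (2 * n ∸ i) (2 * n ∸ j) k
    inΠ-reflect h with inΠ-view h
    ... | point k p q hp hq =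
      subst₂ (λ a b → InΠ G n a b k) (sym (mirror-offset {k} {p} hp)) (sym (mirror-offset {k} {q} hq))
        (inΠ-point (mirror-offset-bound {k} {p} hp) (mirror-offset-bound {k} {q} hq))

    center-reflect : ∀ {i j k} → Center G n i j k → Center G n (2 * n ∸ i) (2 * n ∸ j) k
    center-reflect {k = zero}  (() , _)
    center-reflect {k = suc k} h = inΠ⇒center (inΠ-reflect (center⇒inΠ h))

    reflect-octahedronAt : ∀ {f i j k} → Center G n i j k →
      OctahedronAt f (2 * n ∸ i) (2 * n ∸ j) k → OctahedronAt (reflect f) i j k
    reflect-octahedronAt {f} {i} {j} {k} (_ , _ , k<i , i≤ , k<j , j≤ , _) octahedron = begin
        f (N ∸ (i ∸ 1)) (N ∸ (j ∸ 1)) k ⊕ f (N ∸ suc i) (N ∸ suc j) k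
          ≡⟨ cong₂ _⊕_ (at pred-i pred-j) (at suc-i suc-j) ⟩
        f (suc i′) (suc j′) k ⊕ f (i′ ∸ 1) (j′ ∸ 1) k
          ≡⟨ ⊕-comm _ _ ⟩
        f (i′ ∸ 1) (j′ ∸ 1) k ⊕ f (suc i′) (suc j′) k
          ≡⟨ octahedron ⟩
        (f i′ j′ (k ∸ 1) ⊕ f i′ j′ (suc k)) ∨ (f (i′ ∸ 1) (suc j′) k ⊕ f (suc i′) (j′ ∸ 1) k)
          ≡⟨ cong (upper ∨_) (⊕-comm _ _) ⟩
        (f i′ j′ (k ∸ 1) ⊕ f i′ j′ (suc k)) ∨ (f (suc i′) (j′ ∸ 1) k ⊕ f (i′ ∸ 1) (suc j′) k)
          ≡⟨ cong (upper ∨_) (sym (cong₂ _⊕_ (at pred-i suc-j) (at suc-i pred-j))) ⟩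
        (f i′ j′ (k ∸ 1) ⊕ f i′ j′ (suc k)) ∨ (f (N ∸ (i ∸ 1)) (N ∸ suc j) k ⊕ f (N ∸ suc i) (N ∸ (j ∸ 1)) k)
          ∎
      where
      open ≡-Reasoning
      N = 2 * n
      i′ = N ∸ i
      j′ = N ∸ j
      upper = f i′ j′ (k ∸ 1) ⊕ f i′ j′ (suc k)
      at : ∀ {a a′ b b′} → a ≡ a′ → b ≡ b′ → f a b k ≡ f a′ b′ k
      at = cong₂ (λ a b → f a b k)
      pred-reflect : ∀ {a} → suc k ≤ a → a ≤ N ∸ k ∸ 1 → N ∸ (a ∸ 1) ≡ suc (N ∸ a)
      pred-reflect k<a a≤ =
        m∸[n∸1]≡1+[m∸n] (≤-trans (s≤s z≤n) k<a) (≤-trans a≤ (≤-trans (m∸n≤m (N ∸ k) 1) (m∸n≤m N k)))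
      pred-i = pred-reflect k<i i≤
      pred-j = pred-reflect k<j j≤
      suc-i = m∸[1+n]≡m∸n∸1 N i
      suc-j = m∸[1+n]≡m∸n∸1 N j

    reflect-isPol : ∀ {f} → IsPol G n f → IsPol G n (reflect f)
    reflect-isPol {f} (base , octahedronAt) =
      (λ i j h → base _ _ (inΠ-reflect h)) ,
      (λ i j k h → reflect-octahedronAt {f} h (octahedronAt _ _ _ (center-reflect h)))

    β* : Fun G → Grid G
    β* f = _∘³_ G f (β G n)

    β*-reflect : ∀ f {i j} → i ≤ n → j ≤ n → β* f i j ≡ α* (reflect f) i j
    β*-reflect f {i} {j} i≤n j≤n = cong₂ (λ a b → f a b (i ⊓ j))
      ([m∸n]+o≡m∸[n∸o] (≤-trans (m⊓n≤m i j) (m≤m+n i (i + 0))) (*-monoʳ-≤ 2 i≤n))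
      ([m∸n]+o≡m∸[n∸o] (≤-trans (m⊓n≤n i j) (m≤m+n j (j + 0))) (*-monoʳ-≤ 2 j≤n))

    reflect-β* : ∀ f {i j} → i ≤ n → j ≤ n → β* (reflect f) i j ≡ α* f i j
    reflect-β* f {i} {j} i≤n j≤n = trans (β*-reflect (reflect f) i≤n j≤n) (reflect-involutive f (i ⊓ j)
      (≤-trans (m∸n≤m (2 * i) (i ⊓ j)) (*-monoʳ-≤ 2 i≤n)) (≤-trans (m∸n≤m (2 * j) (i ⊓ j)) (*-monoʳ-≤ 2 j≤n)))

    β*-vanishing : ∀ f → IsPol G n f → Vanishing G n (β* f)
    β*-vanishing f pol i j i≤n j≤n ij≡0 =
      trans (β*-reflect f i≤n j≤n) (α*-vanishing (reflect f) (reflect-isPol {f} pol) i j i≤n j≤n ij≡0)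

    β*-injective : ∀ f f′ → IsPol G n f → IsPol G n f′ → β* f ≈G β* f′ → f ≈Π f′
    β*-injective f f′ pol pol′ β*f≈β*f′ i j k inΠ = begin
        f i j k                    ≡⟨ sym (reflect-involutive f k i≤ j≤) ⟩
        reflect (reflect f) i j k  ≡⟨ α*-injective (reflect f) (reflect f′) (reflect-isPol {f} pol) (reflect-isPol {f′} pol′)
                                        α*f≈α*f′ _ _ _ (inΠ-reflect inΠ) ⟩
        reflect (reflect f′) i j k ≡⟨ reflect-involutive f′ k i≤ j≤ ⟩
        f′ i j k                   ∎
      where
      open ≡-Reasoning
      i≤ = proj₁ (inΠ-bounded inΠ)
      j≤ = proj₂ (inΠ-bounded inΠ)
      α*f≈α*f′ : α* (reflect f) ≈G α* (reflect f′)
      α*f≈α*f′ i j i≤n j≤n =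
        trans (sym (β*-reflect f i≤n j≤n)) (trans (β*f≈β*f′ i j i≤n j≤n) (β*-reflect f′ i≤n j≤n))

    β*-surjective : ∀ g → Vanishing G n g → Σ (Fun G) λ f → IsPol G n f × β* f ≈G g
    β*-surjective g vanish with α*-surjective g vanish
    ... | f , pol , α*f≈g =
      reflect f , reflect-isPol {f} pol , λ i j i≤n j≤n → trans (reflect-β* f i≤n j≤n) (α*f≈g i j i≤n j≤n)

lemma1 : ∀ {c : Level} (G : LOAGroup c) (n : ℕ) →
    PullbackBijective G n (α G n) × PullbackBijective G n (β G n)
lemma1 G n =
  (α*-vanishing G n , α*-injective G n , α*-surjective G n) ,
  (β*-vanishing G n , β*-injective G n , β*-surjective G n)
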